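{- Let $Q^{(1)}$ be an acyclic quiver on $\{1,2,3\}$ with large weights and with arrows oriented $3\to 1$, $1\to 2$ (hence $3\to 2$). Let $a=b_{12}(Q^{(1)})$, $b=b_{31}(Q^{(1)})$, $c=b_{32}(Q^{(1)})$. Define $Q^{(2)}=\mu[1](Q^{(1)})$, $Q^{(3)}=\mu[2](Q^{(2)})$, and in general $Q^{(m+1)}=\mu[1](Q^{(m)})$ for $m$ odd and $Q^{(m+1)}=\mu[2](Q^{(m)})$ for $m$ even (i.e. mutate alternately at $1,2,1,2,\dots$). Then for all $j\ge 0$, $$b_{21}(Q^{(2j+2)})=a,\quad b_{13}(Q^{(2j+2)})=u_{2j}(a)b+u_{2j-1}(a)c,\quad b_{32}(Q^{(2j+2)})=u_{2j+1}(a)b+u_{2j}(a)c,$$ and for all $j>0$, $$b_{12}(Q^{(2j+1)})=a,\quad b_{23}(Q^{(2j+1)})=u_{2j-1}(a)b+u_{2j-2}(a)c,\quad b_{31}(Q^{(2j+1)})=u_{2j}(a)b+u_{2j-1}(a)c.$$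
   Context: A quiver on $\{1,2,3\}$ is a directed multigraph with no loops and no oriented 2-cycles, encoded by the skew-symmetric matrix $B(Q)=(b_{ij})$, $b_{ij}>0$ meaning $b_{ij}$ arrows from $i$ to $j$. Mutation at $k$: $b'_{ij}=-b_{ij}$ if $k\in\{i,j\}$, else $b'_{ij}=b_{ij}+\tfrac12(|b_{ik}|b_{kj}+b_{ik}|b_{kj}|)$. Large weights means $|b_{ij}|\ge 2$ for all $i\ne j$; acyclic means no oriented cycle. The monic Chebyshev polynomials of the second kind $u_j(a)\in\mathbb{Z}[a]$ are defined by $u_0(a)=1$, $u_1(a)=a$, $u_{j+1}(a)=au_j(a)-u_{j-1}(a)$, with the convention $u_{ -1}(a)=0$. -}

module Defs where

open import Data.Nat using (ℕ; zero; suc)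
open import Data.Fin using (Fin; zero; suc)
open import Data.Fin using (_≟_)
open import Data.Integer using (ℤ; +_; _+_; _-_; _*_; -_; ∣_∣; _≤_)
open import Data.Integer.DivMod using (_/_)
open import Relation.Nullary using (yes; no)
open import Relation.Binary.PropositionalEquality using (_≡_)

-- Exchange matrix of a quiver on {1,2,3}; vertex i is Fin index (i - 1).
Mat : Set
Mat = Fin 3 → Fin 3 → ℤ

v1 v2 v3 : Fin 3
v1 = zero
v2 = suc zero
v3 = suc (suc zero)

-- A quiver: skew-symmetric integer matrix (no loops, no 2-cycles encoded).
SkewSymmetric : Mat → Set
SkewSymmetric B = ∀ i j → B i j ≡ - B j i

absℤ : ℤ → ℤ
absℤ x = + ∣ x ∣

mutate : Fin 3 → Mat → Mat
mutate k B i j with i ≟ k | j ≟ k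
... | yes _ | _     = - B i j
... | no _  | yes _ = - B i j
... | no _  | no _  =
  B i j + ((absℤ (B i k) * B k j + B i k * absℤ (B k j)) / + 2)

-- Q^(m) for m ≥ 1: Q^(1) = B, Q^(m+1) = μ_1(Q^(m)) for m odd,
-- Q^(m+1) = μ_2(Q^(m)) for m even.  Q^(0) is an unused dummy (= B).
mutVertex : ℕ → Fin 3     -- vertex to mutate to pass from Q^(m) to Q^(m+1)
mutVertex zero = v2
mutVertex (suc zero) = v1
mutVertex (suc (suc m)) = mutVertex m

Q : Mat → ℕ → Mat
Q B zero = B
Q B (suc zero) = B
Q B (suc (suc m)) = mutate (mutVertex (suc m)) (Q B (suc m))

-- Shifted monic Chebyshev polynomials of the second kind:
-- U n a = u_{n-1}(a), so U 0 = u_{-1} = 0, U 1 = u_0 = 1.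
U : ℕ → ℤ → ℤ
U zero a = + 0
U (suc zero) a = + 1
U (suc (suc n)) a = a * U (suc n) a - U n a

u : ℕ → ℤ → ℤ
u j a = U (suc j) a

-- Put a = b₁₂ and read each quiver of the sequence along the triangle p → o → 3 → p, where p
-- is the next mutation vertex and o the other one of {1, 2}: its weights are (a, q, r).
-- Mutating at p reverses the two arrows at p and, since the path 3 → p → o has weight r·a,
-- turns the triangle into o → p → 3 → o with weights (a, r, a·r − q).  Starting from Q⁽¹⁾,
-- with weights (a, −c, b), the weights obey x_{n+2} = a·x_{n+1} − x_n, x₀ = −c, x₁ = b,
-- whose solution is a combination of Chebyshev polynomials.  For a ≥ 2 this sequence is
-- nondecreasing and nonnegative from x₁ on, which is the sign information every step needs.

module Submission where

open import Defs
open import Data.Nat as ℕ using (ℕ; suc)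
open import Data.Integer using (ℤ; +_; _+_; _*_; _≤_)
open import Data.Product using (_×_)
open import Relation.Binary.PropositionalEquality using (_≡_)

open import Data.Fin using (Fin; _≟_)
open import Data.Integer using (-[1+_]; -_; _-_; _/_; _/ℕ_; 0ℤ; +≤+; nonNegative)
open import Data.Integer.DivMod using (div-pos-is-/ℕ)
open import Data.Integer.Properties
  using (≤-trans; neg-involutive; neg-mono-≤; +-monoʳ-≤; +-monoˡ-≤; *-monoʳ-≤-nonNeg; 0≤i⇒+∣i∣≡i; ∣-i∣≡∣i∣; module ≤-Reasoning)
open import Data.Integer.Tactic.RingSolver using (solve-∀)
import Data.Nat.Properties as ℕ
open import Data.Nat.DivMod using (m*n/n≡m; m*n%n≡0)
open import Data.Product using (_,_; proj₂)
open import Relation.Binary.PropositionalEquality using (_≢_; refl; sym; trans; cong; cong₂; subst₂; module ≡-Reasoning)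
open import Relation.Nullary using (yes; no; contradiction)

-[1+m]/ℕd≡-[[1+m]/d] : ∀ m d .{{_ : ℕ.NonZero d}} → suc m ℕ.% d ≡ 0 → -[1+ m ] /ℕ d ≡ - + (suc m ℕ./ d)
-[1+m]/ℕd≡-[[1+m]/d] m d _ with suc m ℕ.% d
... | 0 = refl

[i+i]/2≡i : ∀ i → (i + i) / + 2 ≡ i
[i+i]/2≡i i = trans (div-pos-is-/ℕ (i + i) 2) ([i+i]/ℕ2≡i i)
  where
  n+n≡n*2 : ∀ n → n ℕ.+ n ≡ n ℕ.* 2
  n+n≡n*2 n = trans (cong (n ℕ.+_) (sym (ℕ.+-identityʳ n))) (ℕ.*-comm 2 n)

  n*2/2≡n : ∀ n → n ℕ.* 2 ℕ./ 2 ≡ n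
  n*2/2≡n n = m*n/n≡m n 2

  [i+i]/ℕ2≡i : ∀ i → (i + i) /ℕ 2 ≡ i
  [i+i]/ℕ2≡i (+ n) = cong +_ (trans (cong (ℕ._/ 2) (n+n≡n*2 n)) (n*2/2≡n n))
  [i+i]/ℕ2≡i -[1+ n ] = begin
    -[1+ suc (n ℕ.+ n) ] /ℕ 2        ≡⟨ -[1+m]/ℕd≡-[[1+m]/d] (suc (n ℕ.+ n)) 2 even ⟩
    - + (suc (suc (n ℕ.+ n)) ℕ./ 2)  ≡⟨ cong (λ m → - + (m ℕ./ 2)) 2+n+n≡[1+n]*2 ⟩
    - + (suc n ℕ.* 2 ℕ./ 2)          ≡⟨ cong (λ m → - + m) (n*2/2≡n (suc n)) ⟩
    -[1+ n ]                         ∎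
    where
    open ≡-Reasoning
    2+n+n≡[1+n]*2 : suc (suc (n ℕ.+ n)) ≡ suc n ℕ.* 2
    2+n+n≡[1+n]*2 = trans (cong suc (sym (ℕ.+-suc n n))) (n+n≡n*2 (suc n))
    even : suc (suc (n ℕ.+ n)) ℕ.% 2 ≡ 0
    even = trans (cong (ℕ._% 2) 2+n+n≡[1+n]*2) (m*n%n≡0 (suc n) 2)

[∣p∣q+p∣q∣]/2≡pq : ∀ {p q} → 0ℤ ≤ p → 0ℤ ≤ q → (absℤ p * q + p * absℤ q) / + 2 ≡ p * q
[∣p∣q+p∣q∣]/2≡pq {p} {q} 0≤p 0≤q = begin
  (absℤ p * q + p * absℤ q) / + 2  ≡⟨ cong₂ (λ x y → (x * q + p * y) / + 2) (0≤i⇒+∣i∣≡i 0≤p) (0≤i⇒+∣i∣≡i 0≤q) ⟩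
  (p * q + p * q) / + 2            ≡⟨ [i+i]/2≡i (p * q) ⟩
  p * q                            ∎
  where open ≡-Reasoning

[∣-p∣-q+-p∣-q∣]/2≡-pq : ∀ {p q} → 0ℤ ≤ p → 0ℤ ≤ q →
  (absℤ (- p) * - q + - p * absℤ (- q)) / + 2 ≡ - (p * q)
[∣-p∣-q+-p∣-q∣]/2≡-pq {p} {q} 0≤p 0≤q = begin
  (absℤ (- p) * - q + - p * absℤ (- q)) / + 2  ≡⟨ cong₂ (λ x y → (x * - q + - p * y) / + 2) ∣-p∣≡p ∣-q∣≡q ⟩
  (p * - q + - p * q) / + 2                    ≡⟨ cong (_/ + 2) (p*-q+-p*q≡-pq+-pq p q) ⟩
  (- (p * q) + - (p * q)) / + 2                ≡⟨ [i+i]/2≡i (- (p * q)) ⟩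
  - (p * q)                                    ∎
  where
  open ≡-Reasoning
  ∣-p∣≡p : absℤ (- p) ≡ p
  ∣-p∣≡p = trans (cong +_ (∣-i∣≡∣i∣ p)) (0≤i⇒+∣i∣≡i 0≤p)
  ∣-q∣≡q : absℤ (- q) ≡ q
  ∣-q∣≡q = trans (cong +_ (∣-i∣≡∣i∣ q)) (0≤i⇒+∣i∣≡i 0≤q)
  p*-q+-p*q≡-pq+-pq : ∀ p q → p * - q + - p * q ≡ - (p * q) + - (p * q)
  p*-q+-p*q≡-pq+-pq = solve-∀

mutate-pivot-row : ∀ k M j → mutate k M k j ≡ - M k j
mutate-pivot-row k M j with k ≟ k | j ≟ k
... | yes _   | _ = refl
... | no k≢k  | _ = contradiction refl k≢k

mutate-pivot-col : ∀ k M i → mutate k M i k ≡ - M i k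
mutate-pivot-col k M i with i ≟ k | k ≟ k
... | yes _ | _       = refl
... | no _  | yes _   = refl
... | no _  | no k≢k  = contradiction refl k≢k

mutate-off-pivot : ∀ {k i j} M → i ≢ k → j ≢ k →
  mutate k M i j ≡ M i j + (absℤ (M i k) * M k j + M i k * absℤ (M k j)) / + 2
mutate-off-pivot {k} {i} {j} M i≢k j≢k with i ≟ k | j ≟ k
... | yes i≡k | _       = contradiction i≡k i≢k
... | no _    | yes j≡k = contradiction j≡k j≢k
... | no _    | no _    = refl

-- All six entries are recorded because `mutate` is not known to preserve skew-symmetry.
record TriangleWeights (M : Mat) (i j k : Fin 3) (p q r : ℤ) : Set where
  field
    ij : M i j ≡ p
    ji : M j i ≡ - p
    jk : M j k ≡ q
    kj : M k j ≡ - q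
    ki : M k i ≡ r
    ik : M i k ≡ - r

mutate-TriangleWeights : ∀ {M i j k p q r} → j ≢ i → k ≢ i → 0ℤ ≤ p → 0ℤ ≤ r →
  TriangleWeights M i j k p q r → TriangleWeights (mutate i M) j i k p r (p * r - q)
mutate-TriangleWeights {M} {i} {j} {k} {p} {q} {r} j≢i k≢i 0≤p 0≤r t = record
  { ij = trans (mutate-pivot-col i M j) (trans (cong -_ (ji t)) (neg-involutive p))
  ; ji = trans (mutate-pivot-row i M j) (cong -_ (ij t))
  ; jk = trans (mutate-pivot-row i M k) (trans (cong -_ (ik t)) (neg-involutive r))
  ; kj = trans (mutate-pivot-col i M k) (cong -_ (ki t))
  ; ki = new-kj
  ; ik = new-jk
  }
  where
  open TriangleWeights

  new-kj : mutate i M k j ≡ p * r - q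
  new-kj rewrite mutate-off-pivot M k≢i j≢i | kj t | ki t | ij t | [∣p∣q+p∣q∣]/2≡pq 0≤r 0≤p =
    -q+rp≡pr-q q r p
    where
    -q+rp≡pr-q : ∀ q r p → - q + r * p ≡ p * r - q
    -q+rp≡pr-q = solve-∀

  new-jk : mutate i M j k ≡ - (p * r - q)
  new-jk rewrite mutate-off-pivot M j≢i k≢i | jk t | ji t | ik t | [∣-p∣-q+-p∣-q∣]/2≡-pq 0≤p 0≤r =
    q+-pr≡-[pr-q] q r p
    where
    q+-pr≡-[pr-q] : ∀ q r p → q + - (p * r) ≡ - (p * r - q)
    q+-pr≡-[pr-q] = solve-∀

chebyshevSeq : ℤ → ℤ → ℤ → ℕ → ℤ
chebyshevSeq a x₀ x₁ 0 = x₀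
chebyshevSeq a x₀ x₁ 1 = x₁
chebyshevSeq a x₀ x₁ (suc (suc n)) = a * chebyshevSeq a x₀ x₁ (suc n) - chebyshevSeq a x₀ x₁ n

chebyshevSeq-suc : ∀ a x₀ x₁ n → chebyshevSeq a x₀ x₁ (suc n) ≡ U (suc n) a * x₁ - U n a * x₀
chebyshevSeq-suc a x₀ x₁ 0 = x₁≡1x₁-0x₀ x₁ x₀
  where
  x₁≡1x₁-0x₀ : ∀ x₁ x₀ → x₁ ≡ + 1 * x₁ - + 0 * x₀
  x₁≡1x₁-0x₀ = solve-∀
chebyshevSeq-suc a x₀ x₁ 1 = ax₁-x₀≡[a1-0]x₁-1x₀ a x₁ x₀
  where
  ax₁-x₀≡[a1-0]x₁-1x₀ : ∀ a x₁ x₀ → a * x₁ - x₀ ≡ (a * + 1 - + 0) * x₁ - + 1 * x₀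
  ax₁-x₀≡[a1-0]x₁-1x₀ = solve-∀
chebyshevSeq-suc a x₀ x₁ (suc (suc n)) = begin
  a * chebyshevSeq a x₀ x₁ (2 ℕ.+ n) - chebyshevSeq a x₀ x₁ (suc n)
    ≡⟨ cong₂ (λ s s′ → a * s - s′) (chebyshevSeq-suc a x₀ x₁ (suc n)) (chebyshevSeq-suc a x₀ x₁ n) ⟩
  a * (U₂ * x₁ - U₁ * x₀) - (U₁ * x₁ - U₀ * x₀)
    ≡⟨ recurrence-linear a U₂ U₁ U₀ x₁ x₀ ⟩
  (a * U₂ - U₁) * x₁ - (a * U₁ - U₀) * x₀
    ∎
  where
  open ≡-Reasoning
  U₀ U₁ U₂ : ℤ
  U₀ = U n a
  U₁ = U (suc n) a
  U₂ = U (2 ℕ.+ n) a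
  recurrence-linear : ∀ a u₂ u₁ u₀ x₁ x₀ →
    a * (u₂ * x₁ - u₁ * x₀) - (u₁ * x₁ - u₀ * x₀) ≡ (a * u₂ - u₁) * x₁ - (a * u₁ - u₀) * x₀
  recurrence-linear = solve-∀

p≤ap-q : ∀ {a p q} → + 2 ≤ a → 0ℤ ≤ p → q ≤ p → p ≤ a * p - q
p≤ap-q {a} {p} {q} 2≤a 0≤p q≤p = begin
  p              ≡⟨ p≡p+p-p p ⟩
  p + p - p      ≤⟨ +-monoʳ-≤ (p + p) (neg-mono-≤ q≤p) ⟩
  p + p - q      ≡⟨ cong (_- q) (p+p≡2p p) ⟩
  + 2 * p - q    ≤⟨ +-monoˡ-≤ (- q) (*-monoʳ-≤-nonNeg p {{nonNegative 0≤p}} 2≤a) ⟩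
  a * p - q      ∎
  where
  open ≤-Reasoning
  p≡p+p-p : ∀ p → p ≡ p + p - p
  p≡p+p-p = solve-∀
  p+p≡2p : ∀ p → p + p ≡ + 2 * p
  p+p≡2p = solve-∀

chebyshevSeq-nondecreasing : ∀ {a x₀ x₁} → + 2 ≤ a → x₀ ≤ x₁ → 0ℤ ≤ x₁ → ∀ n →
  chebyshevSeq a x₀ x₁ n ≤ chebyshevSeq a x₀ x₁ (suc n) × 0ℤ ≤ chebyshevSeq a x₀ x₁ (suc n)
chebyshevSeq-nondecreasing 2≤a x₀≤x₁ 0≤x₁ 0 = x₀≤x₁ , 0≤x₁
chebyshevSeq-nondecreasing 2≤a x₀≤x₁ 0≤x₁ (suc n)
  with chebyshevSeq-nondecreasing 2≤a x₀≤x₁ 0≤x₁ n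
... | xₙ≤xₙ₊₁ , 0≤xₙ₊₁ = step , ≤-trans 0≤xₙ₊₁ step
  where step = p≤ap-q 2≤a 0≤xₙ₊₁ xₙ≤xₙ₊₁

mutVertex-alternates : ∀ n → mutVertex n ≢ mutVertex (suc n)
mutVertex-alternates 0 = λ ()
mutVertex-alternates 1 = λ ()
mutVertex-alternates (suc (suc n)) = mutVertex-alternates n

v3≢mutVertex : ∀ n → v3 ≢ mutVertex n
v3≢mutVertex 0 = λ ()
v3≢mutVertex 1 = λ ()
v3≢mutVertex (suc (suc n)) = v3≢mutVertex n

mutVertex-even : ∀ j → mutVertex (2 ℕ.* j) ≡ v2
mutVertex-even 0 = refl
mutVertex-even (suc j) = trans (cong mutVertex (ℕ.*-suc 2 j)) (mutVertex-even j)

mutVertex-odd : ∀ j → mutVertex (suc (2 ℕ.* j)) ≡ v1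
mutVertex-odd 0 = refl
mutVertex-odd (suc j) = trans (cong (λ n → mutVertex (suc n)) (ℕ.*-suc 2 j)) (mutVertex-odd j)

module AlternatingMutations (B : Mat) (skew : SkewSymmetric B)
  (2≤a : + 2 ≤ B v1 v2) (0≤b : 0ℤ ≤ B v3 v1) (0≤c : 0ℤ ≤ B v3 v2) where

  a b c : ℤ
  a = B v1 v2
  b = B v3 v1
  c = B v3 v2

  x : ℕ → ℤ
  x = chebyshevSeq a (- c) b

  x-suc : ∀ n → x (suc n) ≡ u n a * b + U n a * c
  x-suc n = trans (chebyshevSeq-suc a (- c) b n) (ub-U-c≡ub+Uc (u n a) (U n a) b c)
    where
    ub-U-c≡ub+Uc : ∀ u U b c → u * b - U * - c ≡ u * b + U * c
    ub-U-c≡ub+Uc = solve-∀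

  0≤x-suc : ∀ n → 0ℤ ≤ x (suc n)
  0≤x-suc n = proj₂ (chebyshevSeq-nondecreasing 2≤a -c≤b 0≤b n)
    where
    -c≤b : - c ≤ b
    -c≤b = ≤-trans (neg-mono-≤ 0≤c) 0≤b

  Q-TriangleWeights : ∀ n →
    TriangleWeights (Q B (suc n)) (mutVertex (suc n)) (mutVertex n) v3 a (x n) (x (suc n))
  Q-TriangleWeights 0 = record
    { ij = refl ; ji = skew v2 v1 ; jk = skew v2 v3 ; kj = sym (neg-involutive c) ; ki = refl ; ik = skew v1 v3 }
  Q-TriangleWeights (suc n) =
    mutate-TriangleWeights (mutVertex-alternates n) (v3≢mutVertex (suc n)) (≤-trans (+≤+ ℕ.z≤n) 2≤a)
      (0≤x-suc n) (Q-TriangleWeights n)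

  Q-even : ∀ j → TriangleWeights (Q B (2 ℕ.+ 2 ℕ.* j)) v2 v1 v3 a (x (suc (2 ℕ.* j))) (x (2 ℕ.+ 2 ℕ.* j))
  Q-even j = subst₂ (λ i i′ → TriangleWeights (Q B (2 ℕ.+ 2 ℕ.* j)) i i′ v3 a (x (suc (2 ℕ.* j))) (x (2 ℕ.+ 2 ℕ.* j)))
    (mutVertex-even j) (mutVertex-odd j)
    (Q-TriangleWeights (suc (2 ℕ.* j)))

  Q-odd : ∀ j → TriangleWeights (Q B (suc (2 ℕ.* j))) v1 v2 v3 a (x (2 ℕ.* j)) (x (suc (2 ℕ.* j)))
  Q-odd j = subst₂ (λ i i′ → TriangleWeights (Q B (suc (2 ℕ.* j))) i i′ v3 a (x (2 ℕ.* j)) (x (suc (2 ℕ.* j))))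
    (mutVertex-odd j) (mutVertex-even j) (Q-TriangleWeights (2 ℕ.* j))

  even-quivers : (j : ℕ) →
    Q B (2 ℕ.* j ℕ.+ 2) v2 v1 ≡ a
    × Q B (2 ℕ.* j ℕ.+ 2) v1 v3 ≡ u (2 ℕ.* j) a * b + U (2 ℕ.* j) a * c
    × Q B (2 ℕ.* j ℕ.+ 2) v3 v2 ≡ u (2 ℕ.* j ℕ.+ 1) a * b + u (2 ℕ.* j) a * c
  even-quivers j rewrite ℕ.+-comm (2 ℕ.* j) 2 | ℕ.+-comm (2 ℕ.* j) 1 =
    ij , trans jk (x-suc (2 ℕ.* j)) , trans ki (x-suc (suc (2 ℕ.* j)))
    where open TriangleWeights (Q-even j)

  odd-quivers : (j : ℕ) →
    Q B (2 ℕ.* suc j ℕ.+ 1) v1 v2 ≡ a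
    × Q B (2 ℕ.* suc j ℕ.+ 1) v2 v3 ≡ u (2 ℕ.* j ℕ.+ 1) a * b + u (2 ℕ.* j) a * c
    × Q B (2 ℕ.* suc j ℕ.+ 1) v3 v1 ≡ u (2 ℕ.* suc j) a * b + u (2 ℕ.* j ℕ.+ 1) a * c
  odd-quivers j rewrite ℕ.+-comm (2 ℕ.* suc j) 1 | ℕ.+-comm (2 ℕ.* j) 1 =
    ij
    , trans jk (trans (cong x (ℕ.*-suc 2 j)) (x-suc (suc (2 ℕ.* j))))
    , trans ki (trans (x-suc (2 ℕ.* suc j)) (cong (λ n → u (2 ℕ.* suc j) a * b + U n a * c) (ℕ.*-suc 2 j)))
    where open TriangleWeights (Q-odd (suc j))

proposition3p13 : (B : Mat) → SkewSymmetric B →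
  + 2 ≤ B v1 v2 → + 2 ≤ B v3 v1 → + 2 ≤ B v3 v2 →
  ((j : ℕ) →
    Q B (2 ℕ.* j ℕ.+ 2) v2 v1 ≡ B v1 v2
    × Q B (2 ℕ.* j ℕ.+ 2) v1 v3 ≡ u (2 ℕ.* j) (B v1 v2) * B v3 v1 + U (2 ℕ.* j) (B v1 v2) * B v3 v2
    × Q B (2 ℕ.* j ℕ.+ 2) v3 v2 ≡ u (2 ℕ.* j ℕ.+ 1) (B v1 v2) * B v3 v1 + u (2 ℕ.* j) (B v1 v2) * B v3 v2)
  × ((j : ℕ) →
    Q B (2 ℕ.* suc j ℕ.+ 1) v1 v2 ≡ B v1 v2
    × Q B (2 ℕ.* suc j ℕ.+ 1) v2 v3 ≡ u (2 ℕ.* j ℕ.+ 1) (B v1 v2) * B v3 v1 + u (2 ℕ.* j) (B v1 v2) * B v3 v2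
    × Q B (2 ℕ.* suc j ℕ.+ 1) v3 v1 ≡ u (2 ℕ.* suc j) (B v1 v2) * B v3 v1 + u (2 ℕ.* j ℕ.+ 1) (B v1 v2) * B v3 v2)
proposition3p13 B skew 2≤a 2≤b 2≤c = even-quivers , odd-quivers
  where
  0≤2 : 0ℤ ≤ + 2
  0≤2 = +≤+ ℕ.z≤n
  open AlternatingMutations B skew 2≤a (≤-trans 0≤2 2≤b) (≤-trans 0≤2 2≤c)
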